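{- Let $H$ be a locally finite simple graph, $G$ a locally finite simple graph with an $H$-labeling $\alpha$, and let $p:\tilde G\to G$ be a graph covering map. Then there exists an $H$-labeling $\beta$ of $\tilde G$ such that the map $$\hat p:\tilde G \mathbin{ⓩ}_{\beta} H\to G \mathbin{ⓩ}_{\alpha} H,\qquad \hat p(x,i)=(p(x),i),$$ is a (well-defined) graph covering map.
   Context: All graphs are simple and locally finite. $D(G)=\{(u,e)\in V(G)\times E(G): u\text{ is an endpoint of }e\}$; an $H$-labeling is a function $\alpha:D(G)\to V(H)$. The zig-zag product $G \mathbin{ⓩ}_{\alpha} H$ has vertex set $\{(u,i)\in V(G)\times V(H):\text{there is an edge }e\text{ of }G\text{ containing }u\text{ with }i\sim_H\alpha(u,e)\}$, with $(u,i)\sim(v,j)$ iff there is an edge $e=\{u,v\}\in E(G)$ with $i\sim_H\alpha(u,e)$ and $j\sim_H\alpha(v,e)$. A map $p:\tilde G\to G$ (on vertices) is a graph covering map if (1) $x\sim_{\tilde G}y\Rightarrow p(x)\sim_G p(y)$, and (2) for every vertex $x$ of $\tilde G$, $p$ restricted to the neighbourhood $N(x)$ is a bijection onto $N(p(x))$. -}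

module Defs where

open import Data.Product using (Σ; _×_; _,_; proj₁; proj₂)
open import Data.Unit using (⊤)
open import Data.List using (List)
open import Data.List.Membership.Propositional using (_∈_)
open import Relation.Nullary using (¬_)
open import Relation.Binary.PropositionalEquality using (_≡_)
open import Function.Bundles using (_⇔_)

record Graph : Set₁ where
  field
    V      : Set
    Adj    : V → V → Set
    sym    : ∀ {u v} → Adj u v → Adj v u
    irrefl : ∀ v → ¬ Adj v v
    prop   : ∀ {u v} (a b : Adj u v) → a ≡ b
open Graph public

LocallyFinite : Graph → Set
LocallyFinite G = ∀ v → Σ (List (V G)) λ l → ∀ w → (Adj G v w ⇔ (w ∈ l))

-- Darts D(G) = {(u,e) : u endpoint of e}.  In a simple graph the edge e ∋ u is
-- determined by its other endpoint v, so a dart is (u , v , u~v).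
-- An H-labeling assigns a vertex of H to each dart.
Labeling : Graph → Graph → Set
Labeling G H = (u v : V G) → Adj G u v → V H

-- Zig-zag product, carried on V(G) × V(H); its vertex set is the predicate ZVert.
ZVert : (G H : Graph) → Labeling G H → V G × V H → Set
ZVert G H α (u , i) = Σ (V G) λ v → Σ (Adj G u v) λ a → Adj H i (α u v a)

ZAdj : (G H : Graph) → Labeling G H → V G × V H → V G × V H → Set
ZAdj G H α (u , i) (v , j) =
  Σ (Adj G u v) λ a → Adj H i (α u v a) × Adj H j (α v u (sym G a))

-- Graph covering map between relational graphs (A,R) → (B,S), where the
-- neighbourhood-bijection condition is required at every vertex x with P x
-- (P = vertex set of the source).
record IsCoveringOn {A B : Set} (P : A → Set) (R : A → A → Set) (S : B → B → Set)
                    (f : A → B) : Set where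
  field
    preserves  : ∀ x y → R x y → S (f x) (f y)
    locInj     : ∀ x → P x → ∀ y z → R x y → R x z → f y ≡ f z → y ≡ z
    locSurj    : ∀ x → P x → ∀ w → S (f x) w → Σ A λ y → R x y × f y ≡ w

IsCovering : (G̃ G : Graph) → (V G̃ → V G) → Set
IsCovering G̃ G p = IsCoveringOn {V G̃} {V G} (λ _ → ⊤) (Adj G̃) (Adj G) p

zhat : {G̃ G H : Graph} → (V G̃ → V G) → V G̃ × V H → V G × V H
zhat p (x , i) = (p x , i)

{-# OPTIONS --safe #-}
-- Label every dart of G̃ by the label of its image: β(x, e) = α(p x, p e).  Then the
-- zig-zag adjacency (x, i) ~ (y, j) over an edge e of G̃ is literally the zig-zag
-- adjacency (p x, i) ~ (p y, j) over p e, so the covering property of p at x is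
-- inherited by p̂ at (x, i), with the H-coordinate carried along unchanged.
module Submission where

open import Defs hiding (sym)
open import Data.Product using (Σ; _×_; _,_; proj₁; proj₂)
open import Data.Unit using (tt)
open import Relation.Binary.PropositionalEquality using (_≡_; refl; cong; cong₂; subst; sym)

label-cong : {G H : Graph} (α : Labeling G H) {u u′ v v′ : V G} →
             u ≡ u′ → v ≡ v′ → (a : Adj G u v) (b : Adj G u′ v′) → α u v a ≡ α u′ v′ b
label-cong {G} α {u} {v = v} refl refl a b = cong (α u v) (prop G a b)

module Pullback {G̃ G H : Graph} (p : V G̃ → V G)
                (p-hom : ∀ x y → Adj G̃ x y → Adj G (p x) (p y))
                (α : Labeling G H) where

  pullbackLabeling : Labeling G̃ H
  pullbackLabeling x y a = α (p x) (p y) (p-hom x y a)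

  private
    β = pullbackLabeling
    p̂ = zhat {G̃} {G} {H} p

  zhat-ZVert : ∀ x → ZVert G̃ H β x → ZVert G H α (p̂ x)
  zhat-ZVert (x , i) (y , a , i~βa) = p y , p-hom x y a , i~βa

  zhat-preserves : ∀ x y → ZAdj G̃ H β x y → ZAdj G H α (p̂ x) (p̂ y)
  zhat-preserves (x , i) (y , j) (a , i~βxy , j~βyx) =
    p-hom x y a , i~βxy ,
    subst (Adj H j) (label-cong {G} {H} α refl refl _ _) j~βyx

  zhat-locInj : (∀ x y z → Adj G̃ x y → Adj G̃ x z → p y ≡ p z → y ≡ z) →
                ∀ x y z → ZAdj G̃ H β x y → ZAdj G̃ H β x z → p̂ y ≡ p̂ z → y ≡ z
  zhat-locInj p-locInj (x , _) (y , _) (z , _) (a , _) (b , _) p̂y≡p̂z =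
    cong₂ _,_ (p-locInj x y z a b (cong proj₁ p̂y≡p̂z)) (cong proj₂ p̂y≡p̂z)

  zhat-locSurj : (∀ x v → Adj G (p x) v → Σ (V G̃) λ y → Adj G̃ x y × p y ≡ v) →
                 ∀ x w → ZAdj G H α (p̂ x) w → Σ (V G̃ × V H) λ y → ZAdj G̃ H β x y × p̂ y ≡ w
  zhat-locSurj p-locSurj (x , i) (v , j) (b , i~αb , j~αb′) with p-locSurj x v b
  ... | y , a , py≡v =
    (y , j) ,
    (a , subst (Adj H i) (label-cong {G} {H} α refl (sym py≡v) _ _) i~αb
       , subst (Adj H j) (label-cong {G} {H} α (sym py≡v) refl _ _) j~αb′) ,
    cong (_, j) py≡v

  zhat-isCovering : IsCovering G̃ G p → IsCoveringOn (ZVert G̃ H β) (ZAdj G̃ H β) (ZAdj G H α) p̂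
  zhat-isCovering cov = record
    { preserves = zhat-preserves
    ; locInj    = λ x _ → zhat-locInj (λ x′ → locInj x′ tt) x
    ; locSurj   = λ x _ → zhat-locSurj (λ x′ → locSurj x′ tt) x
    }
    where open IsCoveringOn cov

mainTheorem7 : (H G G̃ : Graph) → LocallyFinite H → LocallyFinite G → LocallyFinite G̃ →
    (α : Labeling G H) → (p : V G̃ → V G) → IsCovering G̃ G p →
    Σ (Labeling G̃ H) λ β →
      ((x : V G̃ × V H) → ZVert G̃ H β x → ZVert G H α (zhat {G̃} {G} {H} p x)) ×
      IsCoveringOn (ZVert G̃ H β) (ZAdj G̃ H β) (ZAdj G H α) (zhat {G̃} {G} {H} p)
mainTheorem7 H G G̃ _ _ _ α p cov =
  pullbackLabeling , zhat-ZVert , zhat-isCovering cov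
  where open Pullback {G̃} {G} {H} p (IsCoveringOn.preserves cov) α
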